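{- Let $A,B$ be non-empty sets, $I$ a non-empty index set, $\{V_i\}_{i\in I}\subseteq\mathcal{R}(A)$, $\{W_i\}_{i\in I}\subseteq\mathcal{R}(B)$, and let $\phi^{(1)},\dots,\phi^{(6)}:\mathcal{R}(A,B)\to\mathcal{R}(A,B)$ be the functions defined below. All functions $\phi^{(t)}$, $t\in\{1,\dots,6\}$, are isotone, and if $A$, $B$ and $I$ are finite, then all of them are image-localized.
   Context: $\mathcal{L}=(L,\wedge,\vee,\otimes,\to,0,1)$ is a complete residuated lattice. $\mathcal{R}(A,B)$: fuzzy relations $A\times B\to L$, ordered pointwise; $\mathcal{R}(A)=\mathcal{R}(A,A)$; $R^{ -1}(b,a)=R(a,b)$; $(R\circ S)(a,c)=\bigvee_b R(a,b)\otimes S(b,c)$. For $R\in\mathcal{R}(A,B)$, $a\in A$, $b\in B$: $\phi^{(1)}(R)(a,b)=\bigwedge_{i\in I}\bigwedge_{a'\in A}\big(V_i(a,a')\to(W_i\circ R^{ -1})(b,a')\big)$, $\phi^{(2)}(R)(a,b)=\bigwedge_{i\in I}\bigwedge_{a'\in A}\big(V_i(a',a)\to(R\circ W_i)(a',b)\big)$, $\gamma(R)(a,b)=\bigwedge_{i\in I}\bigwedge_{b'\in B}\big(W_i(b,b')\to(V_i\circ R)(a,b')\big)$, $\delta(R)(a,b)=\bigwedge_{i\in I}\bigwedge_{b'\in B}\big(W_i(b',b)\to(R^{ -1}\circ V_i)(b',a)\big)$, $\phi^{(3)}=\phi^{(1)}\wedge\gamma$, $\phi^{(4)}=\phi^{(2)}\wedge\delta$,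 $\phi^{(5)}=\phi^{(2)}\wedge\gamma$, $\phi^{(6)}=\phi^{(1)}\wedge\delta$. A function $\phi:\mathcal{R}(A,B)\to\mathcal{R}(A,B)$ is isotone if $R\le S$ implies $\phi(R)\le\phi(S)$. It is image-localized if there is a finite set $K\subseteq L$ such that for every $R\in\mathcal{R}(A,B)$, $\mathrm{im}(\phi(R))\subseteq\langle K\cup\mathrm{im}(R)\rangle$, where $\mathrm{im}(R)=\{R(a,b):a\in A,b\in B\}$ and $\langle X\rangle$ is the subalgebra of $\mathcal{L}$ generated by $X$ (the least subset containing $X\cup\{0,1\}$ closed under $\wedge,\vee,\otimes,\to$). -}

module Defs where

open import Level using (Level; _⊔_) renaming (suc to lsuc)
open import Data.Nat using (ℕ)
open import Data.Fin using (Fin; zero; suc)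
open import Data.List using (List)
open import Data.List.Membership.Propositional using (_∈_)
open import Data.Product using (Σ; ∃; ∃-syntax; _×_; _,_)
open import Data.Sum using (_⊎_)
open import Function.Bundles using (_↔_; _⇔_)
open import Relation.Binary.PropositionalEquality using (_≡_)
open import Relation.Binary.Structures using (IsPartialOrder)

-- A complete residuated lattice (L, ∧, ∨, ⊗, →, 0, 1).
-- Equality on the carrier is propositional equality; arbitrary meets
-- and joins are taken over families indexed by any type in Set.
record CompleteResiduatedLattice (c ℓ : Level) : Set (lsuc (c ⊔ ℓ)) where
  infixr 6 _∧_ _∨_
  infixr 7 _⊗_
  infixr 5 _⇒_
  infix 4 _≤_
  field
    Carrier        : Set c
    _≤_            : Carrier → Carrier → Set ℓ
    isPartialOrder : IsPartialOrder _≡_ _≤_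
    _∧_ _∨_ _⊗_ _⇒_ : Carrier → Carrier → Carrier
    0# 1#          : Carrier
    ⋀ ⋁            : {J : Set} → (J → Carrier) → Carrier
    ⋀-lower    : ∀ {J : Set} (f : J → Carrier) (j : J) → ⋀ f ≤ f j
    ⋀-greatest : ∀ {J : Set} (f : J → Carrier) (x : Carrier) → (∀ j → x ≤ f j) → x ≤ ⋀ f
    ⋁-upper    : ∀ {J : Set} (f : J → Carrier) (j : J) → f j ≤ ⋁ f
    ⋁-least    : ∀ {J : Set} (f : J → Carrier) (x : Carrier) → (∀ j → f j ≤ x) → ⋁ f ≤ x
    ∧-lowerˡ   : ∀ x y → x ∧ y ≤ x
    ∧-lowerʳ   : ∀ x y → x ∧ y ≤ y
    ∧-greatest : ∀ x y z → z ≤ x → z ≤ y → z ≤ x ∧ y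
    ∨-upperˡ   : ∀ x y → x ≤ x ∨ y
    ∨-upperʳ   : ∀ x y → y ≤ x ∨ y
    ∨-least    : ∀ x y z → x ≤ z → y ≤ z → x ∨ y ≤ z
    0-least    : ∀ x → 0# ≤ x
    1-greatest : ∀ x → x ≤ 1#
    ⊗-assoc    : ∀ x y z → (x ⊗ y) ⊗ z ≡ x ⊗ (y ⊗ z)
    ⊗-comm     : ∀ x y → x ⊗ y ≡ y ⊗ x
    ⊗-identityˡ : ∀ x → 1# ⊗ x ≡ x
    residuation : ∀ x y z → (x ⊗ y ≤ z ⇔ x ≤ y ⇒ z)

module WithLattice {c ℓ : Level} (𝓛 : CompleteResiduatedLattice c ℓ) where
  open CompleteResiduatedLattice 𝓛

  Rel : Set → Set → Set c
  Rel A B = A → B → Carrier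

  _⊑_ : {A B : Set} → Rel A B → Rel A B → Set ℓ
  R ⊑ S = ∀ a b → R a b ≤ S a b

  _⁻¹ : {A B : Set} → Rel A B → Rel B A
  (R ⁻¹) b a = R a b

  _∘ᴿ_ : {A B C : Set} → Rel A B → Rel B C → Rel A C
  (R ∘ᴿ S) a c′ = ⋁ (λ b → R a b ⊗ S b c′)

  _⊓_ : {A B : Set} → Rel A B → Rel A B → Rel A B
  (R ⊓ S) a b = R a b ∧ S a b

  module Phis {A B I : Set} (V : I → Rel A A) (W : I → Rel B B) where
    φ1 φ2 γ δ : Rel A B → Rel A B
    φ1 R a b = ⋀ (λ i → ⋀ (λ a′ → V i a a′ ⇒ (W i ∘ᴿ (R ⁻¹)) b a′))
    φ2 R a b = ⋀ (λ i → ⋀ (λ a′ → V i a′ a ⇒ (R ∘ᴿ W i) a′ b))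
    γ  R a b = ⋀ (λ i → ⋀ (λ b′ → W i b b′ ⇒ (V i ∘ᴿ R) a b′))
    δ  R a b = ⋀ (λ i → ⋀ (λ b′ → W i b′ b ⇒ ((R ⁻¹) ∘ᴿ V i) b′ a))

    -- φ⁽¹⁾,…,φ⁽⁶⁾ indexed by Fin 6 (zero ↦ φ⁽¹⁾, …)
    φ : Fin 6 → Rel A B → Rel A B
    φ zero R = φ1 R
    φ (suc zero) R = φ2 R
    φ (suc (suc zero)) R = φ1 R ⊓ γ R
    φ (suc (suc (suc zero))) R = φ2 R ⊓ δ R
    φ (suc (suc (suc (suc zero)))) R = φ2 R ⊓ γ R
    φ (suc (suc (suc (suc (suc zero))))) R = φ1 R ⊓ δ R

  Isotone : {A B : Set} → (Rel A B → Rel A B) → Set (c ⊔ ℓ)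
  Isotone f = ∀ R S → R ⊑ S → f R ⊑ f S

  data ⟨_⟩ (X : Carrier → Set c) : Carrier → Set c where
    gen  : ∀ {x} → X x → ⟨ X ⟩ x
    gen0 : ⟨ X ⟩ 0#
    gen1 : ⟨ X ⟩ 1#
    gen∧ : ∀ {x y} → ⟨ X ⟩ x → ⟨ X ⟩ y → ⟨ X ⟩ (x ∧ y)
    gen∨ : ∀ {x y} → ⟨ X ⟩ x → ⟨ X ⟩ y → ⟨ X ⟩ (x ∨ y)
    gen⊗ : ∀ {x y} → ⟨ X ⟩ x → ⟨ X ⟩ y → ⟨ X ⟩ (x ⊗ y)
    gen⇒ : ∀ {x y} → ⟨ X ⟩ x → ⟨ X ⟩ y → ⟨ X ⟩ (x ⇒ y)

  im : {A B : Set} → Rel A B → Carrier → Set c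
  im {A} {B} R y = Σ A (λ a → Σ B (λ b → R a b ≡ y))

  ImageLocalized : {A B : Set} → (Rel A B → Rel A B) → Set c
  ImageLocalized {A} {B} f =
    Σ (List Carrier) λ K → ∀ (R : Rel A B) (a : A) (b : B) →
      ⟨ (λ y → y ∈ K ⊎ im R y) ⟩ (f R a b)

Finite : Set → Set
Finite A = Σ ℕ λ n → A ↔ Fin n

module Submission where

-- Multiplication, the residual in its second argument, binary
-- and arbitrary meets and joins are monotone in a residuated lattice; hence
-- relational composition and inversion are monotone, and each of φ⁽¹⁾, φ⁽²⁾,
-- γ, δ has the shape ⋀ᵢ ⋀ₓ (c ⇒ (a composite containing R)), which is
-- monotone in R.  Meets of isotone operators are isotone.
--
-- A meet or join over a finite index set equals a finite
-- iterated binary meet or join, so every subalgebra ⟨X⟩ is closed under it.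
-- Consequently composites of relations with values in ⟨X⟩ again take values in
-- ⟨X⟩.  Choosing K to be the finite list of all entries of the V i and W i,
-- every value of φ⁽ᵗ⁾(R) lies in the subalgebra generated by K ∪ im(R).

open import Defs
open import Level using (Level)
open import Data.Nat using (ℕ; zero; suc)
open import Data.Fin using (Fin; zero; suc)
open import Data.Product using (_×_; _,_)
open import Data.Sum using (_⊎_; inj₁; inj₂)
open import Data.List using (List; map; _++_; cartesianProduct; allFin)
open import Data.List.Membership.Propositional using (_∈_)
open import Data.List.Membership.Propositional.Properties
  using (∈-map⁺; ∈-++⁺ˡ; ∈-++⁺ʳ; ∈-cartesianProduct⁺; ∈-allFin)
open import Function.Bundles using (_↔_; Inverse; Equivalence)
open import Relation.Binary.PropositionalEquality using (_≡_; refl; subst; cong; sym)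
open import Relation.Binary.Structures using (IsPartialOrder)

enumerate : {J : Set} → Finite J → List J
enumerate (n , J↔Fin) = map (Inverse.from J↔Fin) (allFin n)

∈-enumerate : {J : Set} (finJ : Finite J) (j : J) → j ∈ enumerate finJ
∈-enumerate (n , J↔Fin) j =
  subst (_∈ map from (allFin n)) (strictlyInverseʳ j) (∈-map⁺ from (∈-allFin (to j)))
  where open Inverse J↔Fin

module Lattice {c ℓ : Level} (𝓛 : CompleteResiduatedLattice c ℓ) where
  open CompleteResiduatedLattice 𝓛
  open WithLattice 𝓛
  open IsPartialOrder isPartialOrder using (antisym; trans) renaming (refl to ≤-refl)

  ≤-reflexive : ∀ {x y} → x ≡ y → x ≤ y
  ≤-reflexive refl = ≤-refl

  -- x ⊗ y ≤ z ⇔ x ≤ y ⇒ z makes (_⊗ y) a left adjoint, hence monotone.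
  ⊗-monoˡ : ∀ {x x′} y → x ≤ x′ → x ⊗ y ≤ x′ ⊗ y
  ⊗-monoˡ {x} {x′} y x≤x′ =
    Equivalence.from (residuation x y (x′ ⊗ y))
      (trans x≤x′ (Equivalence.to (residuation x′ y (x′ ⊗ y)) ≤-refl))

  ⊗-monoʳ : ∀ x {y y′} → y ≤ y′ → x ⊗ y ≤ x ⊗ y′
  ⊗-monoʳ x {y} {y′} y≤y′ =
    subst (_≤ x ⊗ y′) (⊗-comm y x) (subst (y ⊗ x ≤_) (⊗-comm y′ x) (⊗-monoˡ x y≤y′))

  -- (x ⇒_) is a right adjoint, hence monotone.
  ⇒-monoʳ : ∀ x {y y′} → y ≤ y′ → x ⇒ y ≤ x ⇒ y′
  ⇒-monoʳ x {y} {y′} y≤y′ =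
    Equivalence.to (residuation (x ⇒ y) x y′)
      (trans (Equivalence.from (residuation (x ⇒ y) x y) ≤-refl) y≤y′)

  ∧-mono : ∀ {x x′ y y′} → x ≤ x′ → y ≤ y′ → x ∧ y ≤ x′ ∧ y′
  ∧-mono {x} {x′} {y} {y′} x≤x′ y≤y′ =
    ∧-greatest x′ y′ (x ∧ y) (trans (∧-lowerˡ x y) x≤x′) (trans (∧-lowerʳ x y) y≤y′)

  ⋀-mono : ∀ {J : Set} {f g : J → Carrier} → (∀ j → f j ≤ g j) → ⋀ f ≤ ⋀ g
  ⋀-mono {f = f} {g} f≤g = ⋀-greatest g (⋀ f) (λ j → trans (⋀-lower f j) (f≤g j))

  ⋁-mono : ∀ {J : Set} {f g : J → Carrier} → (∀ j → f j ≤ g j) → ⋁ f ≤ ⋁ g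
  ⋁-mono {f = f} {g} f≤g = ⋁-least f (⋁ g) (λ j → trans (f≤g j) (⋁-upper g j))

  ⁻¹-mono : ∀ {A B} {R S : Rel A B} → R ⊑ S → (R ⁻¹) ⊑ (S ⁻¹)
  ⁻¹-mono R⊑S b a = R⊑S a b

  ∘ᴿ-monoˡ : ∀ {A B C} {R R′ : Rel A B} (S : Rel B C) → R ⊑ R′ → (R ∘ᴿ S) ⊑ (R′ ∘ᴿ S)
  ∘ᴿ-monoˡ S R⊑R′ a c′ = ⋁-mono λ b → ⊗-monoˡ (S b c′) (R⊑R′ a b)

  ∘ᴿ-monoʳ : ∀ {A B C} (R : Rel A B) {S S′ : Rel B C} → S ⊑ S′ → (R ∘ᴿ S) ⊑ (R ∘ᴿ S′)
  ∘ᴿ-monoʳ R S⊑S′ a c′ = ⋁-mono λ b → ⊗-monoʳ (R a b) (S⊑S′ b c′)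

  ⊓-isotone : ∀ {A B} {f g : Rel A B → Rel A B} →
              Isotone f → Isotone g → Isotone (λ R → f R ⊓ g R)
  ⊓-isotone f-iso g-iso R S R⊑S a b = ∧-mono (f-iso R S R⊑S a b) (g-iso R S R⊑S a b)

  ⋀ᶠ : (n : ℕ) → (Fin n → Carrier) → Carrier
  ⋀ᶠ zero    g = 1#
  ⋀ᶠ (suc n) g = g zero ∧ ⋀ᶠ n (λ k → g (suc k))

  ⋀ᶠ-lower : ∀ n g (k : Fin n) → ⋀ᶠ n g ≤ g k
  ⋀ᶠ-lower (suc n) g zero    = ∧-lowerˡ _ _
  ⋀ᶠ-lower (suc n) g (suc k) = trans (∧-lowerʳ _ _) (⋀ᶠ-lower n _ k)

  ⋀ᶠ-greatest : ∀ n g x → (∀ k → x ≤ g k) → x ≤ ⋀ᶠ n g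
  ⋀ᶠ-greatest zero    g x x≤g = 1-greatest x
  ⋀ᶠ-greatest (suc n) g x x≤g =
    ∧-greatest _ _ x (x≤g zero) (⋀ᶠ-greatest n _ x (λ k → x≤g (suc k)))

  ⋁ᶠ : (n : ℕ) → (Fin n → Carrier) → Carrier
  ⋁ᶠ zero    g = 0#
  ⋁ᶠ (suc n) g = g zero ∨ ⋁ᶠ n (λ k → g (suc k))

  ⋁ᶠ-upper : ∀ n g (k : Fin n) → g k ≤ ⋁ᶠ n g
  ⋁ᶠ-upper (suc n) g zero    = ∨-upperˡ _ _
  ⋁ᶠ-upper (suc n) g (suc k) = trans (⋁ᶠ-upper n _ k) (∨-upperʳ _ _)

  ⋁ᶠ-least : ∀ n g x → (∀ k → g k ≤ x) → ⋁ᶠ n g ≤ x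
  ⋁ᶠ-least zero    g x g≤x = 0-least x
  ⋁ᶠ-least (suc n) g x g≤x =
    ∨-least _ _ x (g≤x zero) (⋁ᶠ-least n _ x (λ k → g≤x (suc k)))

  ⋀-finite : ∀ {J : Set} (n : ℕ) (J↔Fin : J ↔ Fin n) (f : J → Carrier) →
             ⋀ f ≡ ⋀ᶠ n (λ k → f (Inverse.from J↔Fin k))
  ⋀-finite n J↔Fin f = antisym
    (⋀ᶠ-greatest n _ _ (λ k → ⋀-lower f (from k)))
    (⋀-greatest f _ (λ j → trans (⋀ᶠ-lower n _ (to j)) (≤-reflexive (cong f (strictlyInverseʳ j)))))
    where open Inverse J↔Fin

  ⋁-finite : ∀ {J : Set} (n : ℕ) (J↔Fin : J ↔ Fin n) (f : J → Carrier) →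
             ⋁ f ≡ ⋁ᶠ n (λ k → f (Inverse.from J↔Fin k))
  ⋁-finite n J↔Fin f = antisym
    (⋁-least f _ (λ j → trans (≤-reflexive (cong f (sym (strictlyInverseʳ j)))) (⋁ᶠ-upper n _ (to j))))
    (⋁ᶠ-least n _ _ (λ k → ⋁-upper f (from k)))
    where open Inverse J↔Fin

  module Closure (X : Carrier → Set c) where

    Inside : {A B : Set} → Rel A B → Set c
    Inside R = ∀ a b → ⟨ X ⟩ (R a b)

    ⋀ᶠ-closed : ∀ n g → (∀ k → ⟨ X ⟩ (g k)) → ⟨ X ⟩ (⋀ᶠ n g)
    ⋀ᶠ-closed zero    g g∈ = gen1
    ⋀ᶠ-closed (suc n) g g∈ = gen∧ (g∈ zero) (⋀ᶠ-closed n _ (λ k → g∈ (suc k)))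

    ⋁ᶠ-closed : ∀ n g → (∀ k → ⟨ X ⟩ (g k)) → ⟨ X ⟩ (⋁ᶠ n g)
    ⋁ᶠ-closed zero    g g∈ = gen0
    ⋁ᶠ-closed (suc n) g g∈ = gen∨ (g∈ zero) (⋁ᶠ-closed n _ (λ k → g∈ (suc k)))

    ⋀-closed : ∀ {J : Set} → Finite J → {f : J → Carrier} →
               (∀ j → ⟨ X ⟩ (f j)) → ⟨ X ⟩ (⋀ f)
    ⋀-closed (n , J↔Fin) {f} f∈ =
      subst ⟨ X ⟩ (sym (⋀-finite n J↔Fin f)) (⋀ᶠ-closed n _ (λ k → f∈ (Inverse.from J↔Fin k)))

    ⋁-closed : ∀ {J : Set} → Finite J → {f : J → Carrier} →
               (∀ j → ⟨ X ⟩ (f j)) → ⟨ X ⟩ (⋁ f)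
    ⋁-closed (n , J↔Fin) {f} f∈ =
      subst ⟨ X ⟩ (sym (⋁-finite n J↔Fin f)) (⋁ᶠ-closed n _ (λ k → f∈ (Inverse.from J↔Fin k)))

    ∘ᴿ-closed : ∀ {A B C} → Finite B → {R : Rel A B} {S : Rel B C} →
                Inside R → Inside S → Inside (R ∘ᴿ S)
    ∘ᴿ-closed finB R∈ S∈ a c′ = ⋁-closed finB λ b → gen⊗ (R∈ a b) (S∈ b c′)

  entries : {I A B : Set} → Finite I → Finite A → Finite B → (I → Rel A B) → List Carrier
  entries finI finA finB V =
    map (λ { (i , a , b) → V i a b })
        (cartesianProduct (enumerate finI) (cartesianProduct (enumerate finA) (enumerate finB)))

  ∈-entries : {I A B : Set} (finI : Finite I) (finA : Finite A) (finB : Finite B)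
              (V : I → Rel A B) (i : I) (a : A) (b : B) → V i a b ∈ entries finI finA finB V
  ∈-entries finI finA finB V i a b =
    ∈-map⁺ (λ { (i , a , b) → V i a b })
      (∈-cartesianProduct⁺ (∈-enumerate finI i)
        (∈-cartesianProduct⁺ (∈-enumerate finA a) (∈-enumerate finB b)))

  module Operators {A B I : Set} (V : I → Rel A A) (W : I → Rel B B) where
    open Phis V W

    φ1-isotone : Isotone φ1
    φ1-isotone R S R⊑S a b = ⋀-mono λ i → ⋀-mono λ a′ →
      ⇒-monoʳ _ (∘ᴿ-monoʳ (W i) (⁻¹-mono R⊑S) b a′)

    φ2-isotone : Isotone φ2
    φ2-isotone R S R⊑S a b = ⋀-mono λ i → ⋀-mono λ a′ →
      ⇒-monoʳ _ (∘ᴿ-monoˡ (W i) R⊑S a′ b)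

    γ-isotone : Isotone γ
    γ-isotone R S R⊑S a b = ⋀-mono λ i → ⋀-mono λ b′ →
      ⇒-monoʳ _ (∘ᴿ-monoʳ (V i) R⊑S a b′)

    δ-isotone : Isotone δ
    δ-isotone R S R⊑S a b = ⋀-mono λ i → ⋀-mono λ b′ →
      ⇒-monoʳ _ (∘ᴿ-monoˡ (V i) (⁻¹-mono R⊑S) b′ a)

    φ-isotone : (t : Fin 6) → Isotone (φ t)
    φ-isotone zero                                = φ1-isotone
    φ-isotone (suc zero)                          = φ2-isotone
    φ-isotone (suc (suc zero))                    = ⊓-isotone {f = φ1} {γ} φ1-isotone γ-isotone
    φ-isotone (suc (suc (suc zero)))              = ⊓-isotone {f = φ2} {δ} φ2-isotone δ-isotone
    φ-isotone (suc (suc (suc (suc zero))))        = ⊓-isotone {f = φ2} {γ} φ2-isotone γ-isotone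
    φ-isotone (suc (suc (suc (suc (suc zero))))) = ⊓-isotone {f = φ1} {δ} φ1-isotone δ-isotone

    module Localized (finA : Finite A) (finB : Finite B) (finI : Finite I) where

      K : List Carrier
      K = entries finI finA finA V ++ entries finI finB finB W

      module Fixed (R : Rel A B) where
        open Closure (λ y → y ∈ K ⊎ im R y)

        V-inside : ∀ i → Inside (V i)
        V-inside i a a′ = gen (inj₁ (∈-++⁺ˡ (∈-entries finI finA finA V i a a′)))

        W-inside : ∀ i → Inside (W i)
        W-inside i b b′ =
          gen (inj₁ (∈-++⁺ʳ (entries finI finA finA V) (∈-entries finI finB finB W i b b′)))

        R-inside : Inside R
        R-inside a b = gen (inj₂ (a , b , refl))

        R⁻¹-inside : Inside (R ⁻¹)
        R⁻¹-inside b a = R-inside a b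

        φ1-inside : Inside (φ1 R)
        φ1-inside a b = ⋀-closed finI λ i → ⋀-closed finA λ a′ →
          gen⇒ (V-inside i a a′) (∘ᴿ-closed finB (W-inside i) R⁻¹-inside b a′)

        φ2-inside : Inside (φ2 R)
        φ2-inside a b = ⋀-closed finI λ i → ⋀-closed finA λ a′ →
          gen⇒ (V-inside i a′ a) (∘ᴿ-closed finB R-inside (W-inside i) a′ b)

        γ-inside : Inside (γ R)
        γ-inside a b = ⋀-closed finI λ i → ⋀-closed finB λ b′ →
          gen⇒ (W-inside i b b′) (∘ᴿ-closed finA (V-inside i) R-inside a b′)

        δ-inside : Inside (δ R)
        δ-inside a b = ⋀-closed finI λ i → ⋀-closed finB λ b′ →
          gen⇒ (W-inside i b′ b) (∘ᴿ-closed finA R⁻¹-inside (V-inside i) b′ a)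

        ⊓-inside : {P Q : Rel A B} → Inside P → Inside Q → Inside (P ⊓ Q)
        ⊓-inside P∈ Q∈ a b = gen∧ (P∈ a b) (Q∈ a b)

        φ-inside : (t : Fin 6) → Inside (φ t R)
        φ-inside zero                                = φ1-inside
        φ-inside (suc zero)                          = φ2-inside
        φ-inside (suc (suc zero))                    = ⊓-inside φ1-inside γ-inside
        φ-inside (suc (suc (suc zero)))              = ⊓-inside φ2-inside δ-inside
        φ-inside (suc (suc (suc (suc zero))))        = ⊓-inside φ2-inside γ-inside
        φ-inside (suc (suc (suc (suc (suc zero))))) = ⊓-inside φ1-inside δ-inside

      φ-localized : (t : Fin 6) → ImageLocalized (φ t)
      φ-localized t = K , λ R → Fixed.φ-inside R t

theorem5p2 : ∀ {c ℓ : Level} (𝓛 : CompleteResiduatedLattice c ℓ)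
    {A B I : Set} → A → B → I →
    (V : I → WithLattice.Rel 𝓛 A A) (W : I → WithLattice.Rel 𝓛 B B) →
    ((t : Fin 6) → WithLattice.Isotone 𝓛 (WithLattice.Phis.φ 𝓛 V W t))
    × (Finite A → Finite B → Finite I →
    (t : Fin 6) → WithLattice.ImageLocalized 𝓛 (WithLattice.Phis.φ 𝓛 V W t))
theorem5p2 𝓛 _ _ _ V W =
  φ-isotone , λ finA finB finI → Localized.φ-localized finA finB finI
  where open Lattice.Operators 𝓛 V W
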